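{- Let $\Gamma$ be a weakly distance-regular digraph, let $q\geq3$, and suppose $p_{(1,s-1),(1,t-1)}^{(2,q-2)}\neq0$ for some $s,t$. If $q\in T\setminus\{s\}$, then $(1,q-1)$ is mixed.
   Context: Digraphs are finite with arcs being ordered pairs of distinct vertices; a circuit of length $r$ is a path $(w_0,\dots,w_{r-1})$ with $(w_{r-1},w_0)$ an arc. $\partial$ is the distance, $\tilde\partial(x,y)=(\partial(x,y),\partial(y,x))$, $\tilde\partial(\Gamma)$ its value set. Weakly distance-regular: strongly connected and for $\tilde h,\tilde i,\tilde j\in\tilde\partial(\Gamma)$ the number $p^{\tilde h}_{\tilde i,\tilde j}$ of $z$ with $\tilde\partial(x,z)=\tilde i$, $\tilde\partial(z,y)=\tilde j$ depends only on $\tilde h=\tilde\partial(x,y)$. An arc $(x,y)$ has type $(1,r)$ if $\partial(y,x)=r$; $T=\{q:(1,q-1)\in\tilde\partial(\Gamma)\}$. For $q\in T$, an arc of type $(1,q-1)$ is pure if every circuit of length $q$ containing it consists of arcs of type $(1,q-1)$, otherwise mixed; $(1,q-1)$ is pure if all arcs of type $(1,q-1)$ are pure, and mixed otherwise. -}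

module Defs where

open import Data.Nat using (ℕ; zero; suc; _∸_; _<_; _≤_)
open import Data.Fin using (Fin; zero; suc; inject₁; fromℕ)
open import Data.Fin.Properties using (any?)
open import Data.Bool using (Bool; true; false; _∧_; if_then_else_)
open import Data.List using (List; filter; length; allFin)
open import Data.Product using (_×_; _,_; ∃; ∃-syntax; Σ)
open import Data.Sum using (_⊎_)
open import Relation.Binary.PropositionalEquality using (_≡_; _≢_)
open import Relation.Nullary using (¬_; Dec; yes; no)
open import Relation.Nullary.Decidable using (⌊_⌋)
open import Data.Product.Properties using (≡-dec)
open import Data.Nat.Properties using (_≟_)
open import Function.Definitions using (Injective)

record Digraph (n : ℕ) : Set where
  field
    arc   : Fin n → Fin n → Bool
    loopless : ∀ x → arc x x ≡ false
open Digraph public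

module _ {n : ℕ} (G : Digraph n) where

  walk : ℕ → Fin n → Fin n → Bool
  walk zero    x y = ⌊ x Data.Fin.≟ y ⌋
  walk (suc k) x y = ⌊ any? (λ z → (arc G x z ∧ walk k z y) Data.Bool.≟ true) ⌋

  leastFrom : ℕ → ℕ → Fin n → Fin n → ℕ
  leastFrom k zero        x y = k
  leastFrom k (suc fuel)  x y = if walk k x y then k else leastFrom (suc k) fuel x y

  -- the distance ∂(x,y): length of a shortest path from x to y
  -- (shortest walks are paths and have length < n; value n means unreachable)
  dist : Fin n → Fin n → ℕ
  dist x y = leastFrom 0 n x y

  StronglyConnected : Set
  StronglyConnected = ∀ x y → ∃[ k ] (walk k x y ≡ true)

  dist~ : Fin n → Fin n → ℕ × ℕ
  dist~ x y = (dist x y , dist y x)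

  InDist~ : ℕ × ℕ → Set
  InDist~ h = ∃[ x ] ∃[ y ] (dist~ x y ≡ h)

  _≟²_ : (a b : ℕ × ℕ) → Dec (a ≡ b)
  _≟²_ = ≡-dec _≟_ _≟_

  p : ℕ × ℕ → ℕ × ℕ → Fin n → Fin n → ℕ
  p i j x y = length (filter (λ z → (dist~ x z ≟² i) Relation.Nullary.×-dec (dist~ z y ≟² j)) (allFin n))

  WeaklyDistanceRegular : Set
  WeaklyDistanceRegular =
    StronglyConnected ×
    (∀ i j x y x' y' → InDist~ i → InDist~ j →
       dist~ x y ≡ dist~ x' y' → p i j x y ≡ p i j x' y')

  -- "p^h_{i,j} ≠ 0": h occurs in ∂̃(Γ) and the (well-defined) number is nonzero
  IntersectionNumberNonzero : ℕ × ℕ → ℕ × ℕ → ℕ × ℕ → Set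
  IntersectionNumberNonzero h i j = ∃[ x ] ∃[ y ] (dist~ x y ≡ h × p i j x y ≢ 0)

  InT : ℕ → Set
  InT q = InDist~ (1 , q ∸ 1)

  ArcOfType : ℕ → Fin n → Fin n → Set
  ArcOfType r x y = (arc G x y ≡ true) × (dist y x ≡ r)

  -- a circuit of length suc r: a path w₀,…,w_r (distinct vertices) with
  -- consecutive arcs and closing arc (w_r , w₀)
  record Circuit (r : ℕ) : Set where
    field
      w        : Fin (suc r) → Fin n
      distinct : Injective _≡_ _≡_ w
      arcs     : ∀ (i : Fin r) → arc G (w (inject₁ i)) (w (suc i)) ≡ true
      closing  : arc G (w (fromℕ r)) (w zero) ≡ true

  CircuitArc : ∀ {r} → Circuit r → Fin n → Fin n → Set
  CircuitArc {r} C x y =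
    (∃[ i ] (Circuit.w C (inject₁ i) ≡ x × Circuit.w C (suc i) ≡ y)) ⊎
    (Circuit.w C (fromℕ r) ≡ x × Circuit.w C zero ≡ y)

  MixedArc : ℕ → Fin n → Fin n → Set
  MixedArc q x y =
    ArcOfType (q ∸ 1) x y ×
    Σ (Circuit (q ∸ 1)) λ C →
      CircuitArc C x y ×
      ∃[ u ] ∃[ v ] (CircuitArc C u v × ¬ ArcOfType (q ∸ 1) u v)

  MixedType : ℕ → Set
  MixedType q = ∃[ x ] ∃[ y ] MixedArc q x y

{-# OPTIONS --safe #-}
-- Let (x,y) be an arc of type (1,q-1) and y = P₀, P₁, …, P_{q-1} = x a shortest path back; closed
-- by (x,y) it is a circuit of length q. If its last arc (P_{q-2},x) is not of type (1,q-1), then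
-- (x,y) is mixed. Otherwise ∂(x,P_{q-2}) = q-1, which forces ∂̃(x,P₁) = (2,q-2), so weak
-- distance-regularity gives z with ∂̃(x,z) = (1,s-1) and ∂̃(z,P₁) = (1,t-1). The walk
-- x, z, P₁, …, P_{q-2} has length q-1 = ∂(x,P_{q-2}), hence is a shortest path, and closing it by
-- (P_{q-2},x) gives a circuit of length q through the arc (x,z) of type (1,s-1) ≠ (1,q-1).
module Submission where

open import Defs
open import Data.Nat using (ℕ; zero; suc; _+_; _∸_; _≤_; _<_; z≤n; s≤s; s≤s⁻¹; _<?_)
open import Data.Nat.Properties
open import Data.Nat.Induction using (<-rec)
open import Data.Fin as Fin using (Fin; toℕ; fromℕ<)
import Data.Fin.Properties as Finₚ
open import Data.Fin.Properties using (any?)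
open import Data.Bool using (true; false; _∧_)
open import Data.Bool.Properties using (T-≡; ∧-conicalˡ; ∧-conicalʳ)
open import Data.List using (length; filter; allFin)
import Data.List.Relation.Unary.Any as Any
open import Data.List.Relation.Unary.All.Properties using (¬Any⇒All¬)
open import Data.List.Properties using (filter-none)
open import Data.Product using (_×_; _,_; proj₁; proj₂; ∃; ∃-syntax)
open import Data.Sum using (_⊎_; inj₁; inj₂; [_,_]′)
open import Function.Bundles using (Equivalence)
open import Relation.Binary using (tri<; tri≈; tri>)
open import Relation.Binary.PropositionalEquality
  using (_≡_; _≢_; refl; sym; trans; cong; cong₂; subst; subst₂)
open import Relation.Nullary using (¬_; Dec; yes; no; contradiction; _×-dec_)
open import Relation.Nullary.Decidable using (⌊_⌋; toWitness; fromWitness)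
open import Relation.Unary using (Pred; Decidable)

isYes⇒ : ∀ {a} {A : Set a} (A? : Dec A) → ⌊ A? ⌋ ≡ true → A
isYes⇒ A? eq = toWitness {a? = A?} (Equivalence.from T-≡ eq)

⇒isYes : ∀ {a} {A : Set a} (A? : Dec A) → A → ⌊ A? ⌋ ≡ true
⇒isYes A? a = Equivalence.to T-≡ (fromWitness {a? = A?} a)

i+[k∸j]<k : ∀ {i j k} → i < j → j ≤ k → i + (k ∸ j) < k
i+[k∸j]<k {i} {j} {k} i<j j≤k =
  subst (i + (k ∸ j) <_) (m+[n∸m]≡n j≤k) (+-monoˡ-< (k ∸ j) i<j)

filter-nonempty : ∀ {a p} {A : Set a} {P : Pred A p} (P? : Decidable P) xs →
                  length (filter P? xs) ≢ 0 → ∃ P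
filter-nonempty P? xs len≢0 with Any.any? P? xs
... | yes some = Any.satisfied some
... | no  none = contradiction (cong length (filter-none P? (¬Any⇒All¬ xs none))) len≢0

module _ {n : ℕ} (G : Digraph n) where

  Arc : Fin n → Fin n → Set
  Arc x y = arc G x y ≡ true

  walk-zero⇒≡ : ∀ {x y} → walk G 0 x y ≡ true → x ≡ y
  walk-zero⇒≡ {x} {y} = isYes⇒ (x Fin.≟ y)

  walk-zero-refl : ∀ x → walk G 0 x x ≡ true
  walk-zero-refl x = ⇒isYes (x Fin.≟ x) refl

  walk-suc⇒ : ∀ {k x y} → walk G (suc k) x y ≡ true → ∃[ z ] (Arc x z × walk G k z y ≡ true)
  walk-suc⇒ eq with isYes⇒ (any? _) eq
  ... | z , e = z , ∧-conicalˡ _ _ e , ∧-conicalʳ _ _ e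

  ⇒walk-suc : ∀ {k x z y} → Arc x z → walk G k z y ≡ true → walk G (suc k) x y ≡ true
  ⇒walk-suc {z = z} a w = ⇒isYes (any? _) (z , cong₂ _∧_ a w)

  -- Only vertex 0, …, vertex k are constrained.
  record Walk (k : ℕ) (x y : Fin n) : Set where
    field
      vertex : ℕ → Fin n
      start  : vertex 0 ≡ x
      end    : vertex k ≡ y
      step   : ∀ {i} → i < k → Arc (vertex i) (vertex (suc i))

  open Walk public

  infixr 5 _◅_ _++_

  [] : ∀ {x} → Walk 0 x x
  [] {x} = record { vertex = λ _ → x ; start = refl ; end = refl ; step = λ () }

  _◅_ : ∀ {k x y z} → Arc x y → Walk k y z → Walk (suc k) x z
  _◅_ {k} {x} {y} a W = record { vertex = vertex′ ; start = refl ; end = end W ; step = step′ }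
    where
    vertex′ : ℕ → Fin n
    vertex′ zero    = x
    vertex′ (suc i) = vertex W i

    step′ : ∀ {i} → i < suc k → Arc (vertex′ i) (vertex′ (suc i))
    step′ {zero}  _           = subst (Arc x) (sym (start W)) a
    step′ {suc i} (s≤s i<k)   = step W i<k

  take : ∀ {k x y} (W : Walk k x y) i → i ≤ k → Walk i x (vertex W i)
  take W i i≤k = record
    { vertex = vertex W ; start = start W ; end = refl ; step = λ m<i → step W (≤-trans m<i i≤k) }

  drop : ∀ {k x y} (W : Walk k x y) i → i ≤ k → Walk (k ∸ i) (vertex W i) y
  drop {k} W i i≤k = record
    { vertex = λ m → vertex W (m + i)
    ; start  = refl
    ; end    = trans (cong (vertex W) (m∸n+n≡m i≤k)) (end W)
    ; step   = λ {m} m<k∸i → step W (subst (m + i <_) (m∸n+n≡m i≤k) (+-monoˡ-< i m<k∸i))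
    }

  first-arc : ∀ {k x y} (W : Walk (suc k) x y) → Arc x (vertex W 1)
  first-arc W = subst (λ u → Arc u (vertex W 1)) (start W) (step W (s≤s z≤n))

  last-arc : ∀ {k x y} (W : Walk (suc k) x y) → Arc (vertex W k) y
  last-arc {k} W = subst (Arc (vertex W k)) (end W) (step W (n<1+n k))

  tail : ∀ {k x y} (W : Walk (suc k) x y) → Walk k (vertex W 1) y
  tail W = drop W 1 (s≤s z≤n)

  segment : ∀ {k x y} (W : Walk k x y) {i j} → i ≤ j → j ≤ k →
            Walk (j ∸ i) (vertex W i) (vertex W j)
  segment W {i} {j} i≤j j≤k = drop (take W j j≤k) i i≤j

  _++_ : ∀ {a b x y z} → Walk a x y → Walk b y z → Walk (a + b) x z
  _++_ {zero}  {b} {z = z} W V = subst (λ u → Walk b u z) (trans (sym (end W)) (start W)) V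
  _++_ {suc a}             W V = first-arc W ◅ (tail W ++ V)

  walk⇒Walk : ∀ {k x y} → walk G k x y ≡ true → Walk k x y
  walk⇒Walk {zero}  w = subst (Walk 0 _) (walk-zero⇒≡ w) []
  walk⇒Walk {suc k} w with walk-suc⇒ {k} w
  ... | _ , a , w′ = a ◅ walk⇒Walk w′

  Walk⇒walk : ∀ {k x y} → Walk k x y → walk G k x y ≡ true
  Walk⇒walk {zero}  W = subst₂ (λ u v → walk G 0 u v ≡ true) (start W) (end W) (walk-zero-refl _)
  Walk⇒walk {suc k} W = ⇒walk-suc {k} (first-arc W) (Walk⇒walk (tail W))

  shortcut : ∀ {k x y} (W : Walk k x y) {i j} → i ≤ j → j ≤ k →
             vertex W i ≡ vertex W j → Walk (i + (k ∸ j)) x y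
  shortcut W {i} {j} i≤j j≤k Wi≡Wj =
    take W i (≤-trans i≤j j≤k) ++ subst (λ u → Walk _ u _) (sym Wi≡Wj) (drop W j j≤k)

  leastFrom-≤ : ∀ k fuel {x y j} → k ≤ j → walk G j x y ≡ true → leastFrom G k fuel x y ≤ j
  leastFrom-≤ k zero       k≤j _ = k≤j
  leastFrom-≤ k (suc fuel) {x} {y} {j} k≤j w with walk G k x y in eq
  ... | true  = k≤j
  ... | false with k ≟ j
  ...   | yes refl = contradiction (trans (sym eq) w) λ ()
  ...   | no  k≢j  = leastFrom-≤ (suc k) fuel (≤∧≢⇒< k≤j k≢j) w

  leastFrom-walk : ∀ k fuel {x y} → leastFrom G k fuel x y < k + fuel →
                   walk G (leastFrom G k fuel x y) x y ≡ true
  leastFrom-walk k zero       lt = contradiction (sym (+-identityʳ k)) (<⇒≢ lt)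
  leastFrom-walk k (suc fuel) {x} {y} lt with walk G k x y in eq
  ... | true  = eq
  ... | false =
    leastFrom-walk (suc k) fuel (subst (leastFrom G (suc k) fuel x y <_) (+-suc k fuel) lt)

  dist-≤ : ∀ {k x y} → Walk k x y → dist G x y ≤ k
  dist-≤ W = leastFrom-≤ 0 n z≤n (Walk⇒walk W)

  dist<n⇒Walk : ∀ {x y} → dist G x y < n → Walk (dist G x y) x y
  dist<n⇒Walk d<n = walk⇒Walk (leastFrom-walk 0 n d<n)

  shorten : ∀ {k x y} → Walk k x y → ∃[ j ] (j < n × Walk j x y)
  shorten {k} {x} {y} = <-rec (λ k → Walk k x y → ∃[ j ] (j < n × Walk j x y)) go k
    where
    go : ∀ k → (∀ {j} → j < k → Walk j x y → ∃[ j ] (j < n × Walk j x y)) →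
         Walk k x y → ∃[ j ] (j < n × Walk j x y)
    go k rec W with k <? n
    ... | yes k<n = k , k<n , W
    ... | no  k≮n with Finₚ.pigeonhole (s≤s (≮⇒≥ k≮n)) (λ i → vertex W (toℕ i))
    ...   | i , j , i<j , Wi≡Wj = rec (i+[k∸j]<k i<j j≤k) (shortcut W (<⇒≤ i<j) j≤k Wi≡Wj)
      where j≤k = s≤s⁻¹ (Finₚ.toℕ<n j)

  geodesic-injective : ∀ {k x y} (W : Walk k x y) → dist G x y ≡ k →
                       ∀ {i j} → i < j → j ≤ k → vertex W i ≢ vertex W j
  geodesic-injective W d i<j j≤k Wi≡Wj =
    <⇒≱ (i+[k∸j]<k i<j j≤k) (subst (_≤ _) d (dist-≤ (shortcut W (<⇒≤ i<j) j≤k Wi≡Wj)))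

  module _ {r x y} (W : Walk r x y) (geo : dist G x y ≡ r) (yx : Arc y x) where

    closedGeodesic : Circuit G r
    closedGeodesic = record
      { w        = λ i → vertex W (toℕ i)
      ; distinct = distinct
      ; arcs     = λ i → subst (λ k → Arc (vertex W k) (vertex W (suc (toℕ i))))
                               (sym (Finₚ.toℕ-inject₁ i)) (step W (Finₚ.toℕ<n i))
      ; closing  = subst₂ Arc (sym (trans (cong (vertex W) (Finₚ.toℕ-fromℕ r)) (end W)))
                              (sym (start W)) yx
      }
      where
      ≤-last : (i : Fin (suc r)) → toℕ i ≤ r
      ≤-last i = s≤s⁻¹ (Finₚ.toℕ<n i)

      distinct : ∀ {i j : Fin (suc r)} → vertex W (toℕ i) ≡ vertex W (toℕ j) → i ≡ j
      distinct {i} {j} Wi≡Wj with <-cmp (toℕ i) (toℕ j)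
      ... | tri< i<j _ _ = contradiction Wi≡Wj (geodesic-injective W geo i<j (≤-last j))
      ... | tri≈ _ i≡j _ = Finₚ.toℕ-injective i≡j
      ... | tri> _ _ j<i = contradiction (sym Wi≡Wj) (geodesic-injective W geo j<i (≤-last i))

    closedGeodesic-closingArc : CircuitArc G closedGeodesic y x
    closedGeodesic-closingArc = inj₂ (trans (cong (vertex W) (Finₚ.toℕ-fromℕ r)) (end W) , start W)

    closedGeodesic-stepArc : ∀ {i} → i < r →
                             CircuitArc G closedGeodesic (vertex W i) (vertex W (suc i))
    closedGeodesic-stepArc i<r =
      inj₁ (fromℕ< i<r , cong (vertex W) (trans (Finₚ.toℕ-inject₁ _) (Finₚ.toℕ-fromℕ< i<r))
                       , cong (λ k → vertex W (suc k)) (Finₚ.toℕ-fromℕ< i<r))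

  closingArc-mixed : ∀ {r x y} (W : Walk r x y) → ArcOfType G r y x →
                     ∀ {i} → i < r → ¬ ArcOfType G r (vertex W i) (vertex W (suc i)) →
                     MixedArc G (suc r) y x
  closingArc-mixed W yx@(yx-arc , geo) i<r ¬type =
    yx , closedGeodesic W geo yx-arc , closedGeodesic-closingArc W geo yx-arc ,
    _ , _ , closedGeodesic-stepArc W geo yx-arc i<r , ¬type

  mixed⊎lastArcOfType : ∀ {k x y} → ArcOfType G (suc k) x y → (W : Walk (suc k) y x) →
                        MixedArc G (2 + k) x y ⊎ ArcOfType G (suc k) (vertex W k) x
  mixed⊎lastArcOfType {k} {x} xy W with dist G x (vertex W k) ≟ suc k
  ... | yes geo = inj₂ (last-arc W , geo)
  ... | no ¬geo = inj₁ (closingArc-mixed W xy (n<1+n k) λ (_ , geo) →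
                          ¬geo (subst (λ u → dist G u (vertex W k) ≡ suc k) (end W) geo))

  p≢0⇒∃ : ∀ {i j x y} → p G i j x y ≢ 0 → ∃[ z ] (dist~ G x z ≡ i × dist~ G z y ≡ j)
  p≢0⇒∃ = filter-nonempty _ (allFin n)

  intersectionNumber-nonzero : WeaklyDistanceRegular G → ∀ {h i j} →
                               IntersectionNumberNonzero G h i j →
                               ∀ {x y} → dist~ G x y ≡ h → p G i j x y ≢ 0
  intersectionNumber-nonzero (_ , wdr) {i = i} {j} (x₀ , y₀ , x₀y₀≡h , p₀≢0) {x} {y} xy≡h
    with z₀ , x₀z₀≡i , z₀y₀≡j ← p≢0⇒∃ p₀≢0 = λ p≡0 → p₀≢0 (trans p₀≡p p≡0)
    where
    p₀≡p : p G i j x₀ y₀ ≡ p G i j x y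
    p₀≡p = wdr _ _ x₀ y₀ x y (x₀ , z₀ , x₀z₀≡i) (z₀ , y₀ , z₀y₀≡j) (trans x₀y₀≡h (sym xy≡h))

  module _ (sc : StronglyConnected G) where

    dist<n : ∀ x y → dist G x y < n
    dist<n x y with k , walk-k ← sc x y with j , j<n , W ← shorten (walk⇒Walk {k} walk-k) =
      ≤-<-trans (dist-≤ W) j<n

    geodesic : ∀ x y → Walk (dist G x y) x y
    geodesic x y = dist<n⇒Walk (dist<n x y)

    dist-triangle : ∀ x y z → dist G x z ≤ dist G x y + dist G y z
    dist-triangle x y z = dist-≤ (geodesic x y ++ geodesic y z)

    dist≡1⇒Arc : ∀ {x y} → dist G x y ≡ 1 → Arc x y
    dist≡1⇒Arc {x} {y} d≡1 = subst (Arc x) (end W) (first-arc W)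
      where W = subst (λ k → Walk k x y) d≡1 (geodesic x y)

    ≤dist-via-walk : ∀ {a b x y z} → dist G x z ≡ a + b → Walk b y z → a ≤ dist G x y
    ≤dist-via-walk {a} {b} {x} {y} {z} xz≡a+b W = +-cancelʳ-≤ b a (dist G x y) (begin
      a + b                     ≡⟨ sym xz≡a+b ⟩
      dist G x z                ≤⟨ dist-triangle x y z ⟩
      dist G x y + dist G y z   ≤⟨ +-monoʳ-≤ (dist G x y) (dist-≤ W) ⟩
      dist G x y + b            ∎)
      where open ≤-Reasoning

    geodesic-suffix : ∀ {k x y} (W : Walk k x y) → dist G x y ≡ k →
                      ∀ {i} → i ≤ k → dist G (vertex W i) y ≡ k ∸ i
    geodesic-suffix {k} {x} {y} W geo {i} i≤k =
      ≤-antisym (dist-≤ (drop W i i≤k)) (m≤n+o⇒m∸n≤o k i (begin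
        k                                         ≡⟨ sym geo ⟩
        dist G x y                                ≤⟨ dist-triangle x (vertex W i) y ⟩
        dist G x (vertex W i) + dist G (vertex W i) y  ≤⟨ +-monoˡ-≤ _ (dist-≤ (take W i i≤k)) ⟩
        i + dist G (vertex W i) y                 ∎))
      where open ≤-Reasoning

    secondVertex-dist~ : ∀ {m x y} → ArcOfType G (2 + m) x y → (W : Walk (2 + m) y x) →
                         dist G x (vertex W (suc m)) ≡ 2 + m → dist~ G x (vertex W 1) ≡ (2 , suc m)
    secondVertex-dist~ {m} (xy , geo) W xv≡2+m = cong₂ _,_
      (≤-antisym (dist-≤ (xy ◅ first-arc W ◅ []))
                 (≤dist-via-walk xv≡2+m (segment W (s≤s z≤n) (n≤1+n (suc m)))))
      (geodesic-suffix W geo (s≤s z≤n))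

    lastArcOfType-mixed : WeaklyDistanceRegular G → ∀ {m s t} →
                          IntersectionNumberNonzero G (2 , suc m) (1 , s ∸ 1) (1 , t ∸ 1) →
                          s ∸ 1 ≢ 2 + m →
                          ∀ {x y} → ArcOfType G (2 + m) x y → (W : Walk (2 + m) y x) →
                          ArcOfType G (2 + m) (vertex W (suc m)) x →
                          MixedArc G (3 + m) (vertex W (suc m)) x
    lastArcOfType-mixed wdr {m} nz s∸1≢2+m xy W vx
      with z , xz , za ← p≢0⇒∃ (intersectionNumber-nonzero wdr nz
                                  (secondVertex-dist~ xy W (proj₂ vx))) =
      closingArc-mixed detour vx (s≤s z≤n) λ (_ , zx≡2+m) →
        s∸1≢2+m (trans (sym (cong proj₂ xz)) zx≡2+m)
      where
      detour : Walk (2 + m) _ (vertex W (suc m))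
      detour = dist≡1⇒Arc (cong proj₁ xz) ◅ dist≡1⇒Arc (cong proj₁ za) ◅
               segment W (s≤s z≤n) (n≤1+n (suc m))

lemma2p2 : ∀ {n} (G : Digraph n) → WeaklyDistanceRegular G →
    ∀ (q s t : ℕ) → 3 ≤ q →
    IntersectionNumberNonzero G (2 , q ∸ 2) (1 , s ∸ 1) (1 , t ∸ 1) →
    InT G q → q ≢ s →
    MixedType G q
lemma2p2 G wdr@(sc , _) (suc (suc (suc m))) s t (s≤s (s≤s (s≤s _))) nz (x , y , xy≡) q≢s =
  [ (λ xy-mixed → x , y , xy-mixed)
  , (λ lastArc → _ , x , lastArcOfType-mixed G sc wdr {s = s} {t} nz (s∸1≢2+m q≢s) xy P lastArc)
  ]′ (mixed⊎lastArcOfType G xy P)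
  where
  xy : ArcOfType G (2 + m) x y
  xy = dist≡1⇒Arc G sc (cong proj₁ xy≡) , cong proj₂ xy≡

  P : Walk G (2 + m) y x
  P = subst (λ k → Walk G k y x) (cong proj₂ xy≡) (geodesic G sc y x)

  s∸1≢2+m : ∀ {s′} → 3 + m ≢ s′ → s′ ∸ 1 ≢ 2 + m
  s∸1≢2+m {zero}   _    ()
  s∸1≢2+m {suc s′} q≢s′ s′≡2+m = q≢s′ (cong suc (sym s′≡2+m))
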